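{- Let $G$ and $H$ be graphs with $G$ connected. Then $$\xi(G \odot H) \le \beta(\widehat{G})\,\mathrm{n}(H) + \mathrm{n}(G).$$
   Context: All graphs are finite, simple and undirected; $\mathrm{n}(H)$ denotes the order of $H$. For a connected graph $\Gamma$, a set $S\subseteq V(\Gamma)$ is a distance-equalizer set if for every two distinct $u,v\in V(\Gamma)\setminus S$ there is $w\in S$ with $d_\Gamma(w,u)=d_\Gamma(w,v)$; $\xi(\Gamma)$ is the minimum cardinality of a distance-equalizer set of $\Gamma$. For $V(G)=\{v_1,\dots,v_n\}$, the corona product $G\odot H$ is obtained from $G$ and $n$ pairwise disjoint copies $H_1,\dots,H_n$ of $H$ by joining $v_i$ to every vertex of $H_i$. The empty bisector graph $\widehat{G}$ has vertex set $V(G)$, with distinct $u,v$ adjacent iff there is no $w\in V(G)$ with $d_G(w,u)=d_G(w,v)$. $\beta$ denotes the vertex cover number. -}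

module Defs where

open import Data.Nat using (ℕ; zero; suc; _+_; _*_; _≤_)
open import Data.Fin using (Fin; splitAt; remQuot)
open import Data.Fin.Subset using (Subset; _∈_; _∉_; ∣_∣)
open import Data.Sum using (_⊎_; inj₁; inj₂)
open import Data.Product using (Σ; _×_; _,_; ∃; ∃-syntax)
open import Data.Empty using (⊥)
open import Relation.Nullary using (¬_)
open import Relation.Binary.PropositionalEquality using (_≡_; refl; sym; _≢_)
open import Level using (0ℓ)

record Graph (n : ℕ) : Set₁ where
  field
    Adj    : Fin n → Fin n → Set
    adj-sym    : ∀ {u v} → Adj u v → Adj v u
    adj-irrefl : ∀ {u} → ¬ Adj u u
open Graph public

order : ∀ {n} → Graph n → ℕ
order {n} _ = n

data Walk {n : ℕ} (G : Graph n) : Fin n → Fin n → ℕ → Set where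
  here : ∀ {u} → Walk G u u 0
  step : ∀ {u v w k} → Adj G u v → Walk G v w k → Walk G u w (suc k)

Dist : ∀ {n} → Graph n → Fin n → Fin n → ℕ → Set
Dist G u v k = Walk G u v k × (∀ m → Walk G u v m → k ≤ m)

Connected : ∀ {n} → Graph n → Set
Connected {n} G = ∀ (u v : Fin n) → ∃[ k ] Walk G u v k

Equidistant : ∀ {n} → Graph n → Fin n → Fin n → Fin n → Set
Equidistant G w u v = ∃[ k ] (Dist G w u k × Dist G w v k)

IsDistanceEqualizer : ∀ {n} → Graph n → Subset n → Set
IsDistanceEqualizer {n} G S =
  ∀ (u v : Fin n) → u ≢ v → u ∉ S → v ∉ S →
    Σ (Fin n) λ w → w ∈ S × Equidistant G w u v

IsMinCard : ∀ {n} → (Subset n → Set) → ℕ → Set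
IsMinCard P k = (Σ _ λ S → P S × ∣ S ∣ ≡ k) × (∀ S → P S → k ≤ ∣ S ∣)

IsXi : ∀ {n} → Graph n → ℕ → Set
IsXi G = IsMinCard (IsDistanceEqualizer G)

IsVertexCover : ∀ {n} → Graph n → Subset n → Set
IsVertexCover {n} G C = ∀ (u v : Fin n) → Adj G u v → u ∈ C ⊎ v ∈ C

IsVertexCoverNumber : ∀ {n} → Graph n → ℕ → Set
IsVertexCoverNumber G = IsMinCard (IsVertexCover G)

EBAdj : ∀ {n} → Graph n → Fin n → Fin n → Set
EBAdj {n} G u v = u ≢ v × ¬ (Σ (Fin n) λ w → Equidistant G w u v)

emptyBisector : ∀ {n} → Graph n → Graph n
emptyBisector G = record
  { Adj = EBAdj G
  ; adj-sym = λ { (u≢v , nw) → (λ e → u≢v (sym e))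
                         , (λ { (w , k , d1 , d2) → nw (w , k , d2 , d1) }) }
  ; adj-irrefl = λ { (u≢u , _) → u≢u refl }
  }

-- corona product G ⊙ H, with G on Fin n and H on Fin m.
-- Vertex set Fin (n + n * m): the first n vertices are those of G,
-- and vertex (i , a) of the rest is vertex a of the copy H_i.
CVertex : ℕ → ℕ → Set
CVertex n m = Fin n ⊎ (Fin n × Fin m)

decode : ∀ n m → Fin (n + n * m) → CVertex n m
decode n m x with splitAt n x
... | inj₁ i = inj₁ i
... | inj₂ y = inj₂ (remQuot m y)

CAdj : ∀ {n m} → Graph n → Graph m → CVertex n m → CVertex n m → Set
CAdj G H (inj₁ i) (inj₁ j) = Adj G i j
CAdj G H (inj₁ i) (inj₂ (j , b)) = i ≡ j
CAdj G H (inj₂ (i , a)) (inj₁ j) = i ≡ j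
CAdj G H (inj₂ (i , a)) (inj₂ (j , b)) = i ≡ j × Adj H a b

CAdj-sym : ∀ {n m} (G : Graph n) (H : Graph m) (s t : CVertex n m) →
           CAdj G H s t → CAdj G H t s
CAdj-sym G H (inj₁ i) (inj₁ j) p = adj-sym G p
CAdj-sym G H (inj₁ i) (inj₂ _) p = sym p
CAdj-sym G H (inj₂ _) (inj₁ j) p = sym p
CAdj-sym G H (inj₂ _) (inj₂ _) (e , p) = sym e , adj-sym H p

CAdj-irrefl : ∀ {n m} (G : Graph n) (H : Graph m) (s : CVertex n m) →
              ¬ CAdj G H s s
CAdj-irrefl G H (inj₁ i) p = adj-irrefl G p
CAdj-irrefl G H (inj₂ _) (_ , p) = adj-irrefl H p

corona : ∀ {n m} → Graph n → Graph m → Graph (n + n * m)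
corona {n} {m} G H = record
  { Adj = λ x y → CAdj G H (decode n m x) (decode n m y)
  ; adj-sym = λ {x} {y} → CAdj-sym G H (decode n m x) (decode n m y)
  ; adj-irrefl = λ {x} → CAdj-irrefl G H (decode n m x)
  }

{-# OPTIONS --safe #-}
module Submission where

open import Defs
open import Data.Nat using (ℕ; zero; suc; _+_; _*_; _≤_; _≤?_; z≤n; s≤s)
open import Data.Nat.Properties using (≤-refl; ≤-trans; ≤-reflexive; m≤n⇒m≤1+n; +-suc; +-comm; module ≤-Reasoning)
open import Data.Fin using (Fin; splitAt; remQuot; combine; _↑ˡ_; _↑ʳ_; _≟_)
open import Data.Fin.Properties using (∀-cons; splitAt-↑ˡ; splitAt-↑ʳ; splitAt⁻¹-↑ˡ; splitAt⁻¹-↑ʳ; remQuot-combine; combine-remQuot)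
open import Data.Fin.Subset using (Subset; _∈_; _∉_; ∣_∣; inside; outside; ⊤)
open import Data.Fin.Subset.Properties using (∣⊤∣≡n; ∣⊥∣≡0)
open import Data.Vec using ([]; _∷_; _++_; concat; map; replicate; lookup)
open import Data.Vec.Properties using (lookup-++ˡ; lookup-++ʳ; lookup-concat; lookup-map; lookup-replicate; lookup⇒[]=; []=⇒lookup)
open import Data.Sum using (inj₁; inj₂; [_,_]′)
open import Data.Product using (Σ; _×_; _,_; ∃-syntax; proj₁; proj₂)
open import Data.Empty using (⊥-elim)
open import Function using (_∘_)
open import Relation.Nullary using (¬_; yes; no)
open import Relation.Nullary.Negation using (¬¬-map; contradiction)
open import Relation.Nullary.Decidable using (decidable-stable)
open import Relation.Binary.PropositionalEquality using (_≡_; refl; sym; trans; cong; cong₂; subst; subst₂; module ≡-Reasoning)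

-- Let C be a vertex cover of the empty bisector graph of G, and S the set of the vertices of G
-- together with those of the copies H_i with i ∈ C, so |S| = n(G) + |C| n(H).  Two vertices
-- outside S are leaves (i,a), (j,b) with i, j ∉ C.  If i = j, the vertex i is equidistant from
-- both; otherwise ij is not an edge of the empty bisector graph, so some w is equidistant from
-- i and j in G, hence from (i,a) and (j,b) in G ⊙ H, as d(w,(i,a)) = d_G(w,i) + 1.
-- A non-edge of the empty bisector graph yields such a w only up to double negation; this is
-- harmless because the bound is decidable and ¬¬ commutes with quantifiers over Fin.

¬¬-∀-Fin : ∀ {n} {P : Fin n → Set} → (∀ i → ¬ ¬ P i) → ¬ ¬ (∀ i → P i)
¬¬-∀-Fin {zero}  _  k = k (λ ())
¬¬-∀-Fin {suc n} ¬¬P k =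
  ¬¬P Fin.zero λ P0 → ¬¬-∀-Fin (¬¬P ∘ Fin.suc) λ Psuc → k (∀-cons P0 Psuc)

¬¬-→ : ∀ {A B : Set} → (A → ¬ ¬ B) → ¬ ¬ (A → B)
¬¬-→ f k = k λ a → ⊥-elim (f a λ b → k λ _ → b)

∣p++q∣≡∣p∣+∣q∣ : ∀ {k l} (p : Subset k) (q : Subset l) → ∣ p ++ q ∣ ≡ ∣ p ∣ + ∣ q ∣
∣p++q∣≡∣p∣+∣q∣ []            q = refl
∣p++q∣≡∣p∣+∣q∣ (inside ∷ p)  q = cong suc (∣p++q∣≡∣p∣+∣q∣ p q)
∣p++q∣≡∣p∣+∣q∣ (outside ∷ p) q = ∣p++q∣≡∣p∣+∣q∣ p q

∣concat-replicate∣ : ∀ {k} m (p : Subset k) → ∣ concat (map (replicate m) p) ∣ ≡ ∣ p ∣ * m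
∣concat-replicate∣ m []            = refl
∣concat-replicate∣ m (inside ∷ p)  =
  trans (∣p++q∣≡∣p∣+∣q∣ (⊤ {m}) _) (cong₂ _+_ (∣⊤∣≡n m) (∣concat-replicate∣ m p))
∣concat-replicate∣ m (outside ∷ p) =
  trans (∣p++q∣≡∣p∣+∣q∣ (replicate m outside) _) (cong₂ _+_ (∣⊥∣≡0 m) (∣concat-replicate∣ m p))

module _ {n m : ℕ} where

  base : Fin n → Fin (n + n * m)
  base i = i ↑ˡ (n * m)

  leaf : Fin n → Fin m → Fin (n + n * m)
  leaf i a = n ↑ʳ combine i a

  decode-base : ∀ i → decode n m (base i) ≡ inj₁ i
  decode-base i rewrite splitAt-↑ˡ n i (n * m) = refl

  decode-leaf : ∀ i a → decode n m (leaf i a) ≡ inj₂ (i , a)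
  decode-leaf i a rewrite splitAt-↑ʳ n (n * m) (combine i a) | remQuot-combine {n} {m} i a = refl

  data CoronaView : Fin (n + n * m) → Set where
    base-view : ∀ i → CoronaView (base i)
    leaf-view : ∀ i a → CoronaView (leaf i a)

  coronaView : ∀ x → CoronaView x
  coronaView x with splitAt n x in eq
  ... | inj₁ i = subst CoronaView (splitAt⁻¹-↑ˡ eq) (base-view i)
  ... | inj₂ y = subst CoronaView (trans (cong (n ↑ʳ_) (combine-remQuot {n} m y)) (splitAt⁻¹-↑ʳ eq))
                   (leaf-view (proj₁ (remQuot {n} m y)) (proj₂ (remQuot {n} m y)))

  host : CVertex n m → Fin n
  host (inj₁ i)       = i
  host (inj₂ (i , _)) = i

  depth : CVertex n m → ℕ
  depth (inj₁ _) = 0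
  depth (inj₂ _) = 1

  leavesOver : Subset n → Subset (n * m)
  leavesOver C = concat (map (replicate m) C)

  basesAndLeavesOver : Subset n → Subset (n + n * m)
  basesAndLeavesOver C = ⊤ ++ leavesOver C

  module _ (C : Subset n) where

    private
      S : Subset (n + n * m)
      S = basesAndLeavesOver C

    base∈ : ∀ i → base i ∈ S
    base∈ i = lookup⇒[]= (base i) S
      (trans (lookup-++ˡ (⊤ {n}) (leavesOver C) i) (lookup-replicate i inside))

    leaf∈ : ∀ {i} a → i ∈ C → leaf i a ∈ S
    leaf∈ {i} a i∈C = lookup⇒[]= (leaf i a) S (begin
      lookup S (leaf i a)                       ≡⟨ lookup-++ʳ (⊤ {n}) (leavesOver C) (combine i a) ⟩
      lookup (leavesOver C) (combine i a)       ≡⟨ lookup-concat (map (replicate m) C) i a ⟩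
      lookup (lookup (map (replicate m) C) i) a ≡⟨ cong (λ v → lookup v a) (lookup-map i (replicate m) C) ⟩
      lookup (replicate m (lookup C i)) a       ≡⟨ lookup-replicate a (lookup C i) ⟩
      lookup C i                                ≡⟨ []=⇒lookup i∈C ⟩
      inside                                    ∎)
      where open ≡-Reasoning

    ∣basesAndLeavesOver∣ : ∣ S ∣ ≡ n + ∣ C ∣ * m
    ∣basesAndLeavesOver∣ =
      trans (∣p++q∣≡∣p∣+∣q∣ (⊤ {n}) (leavesOver C)) (cong₂ _+_ (∣⊤∣≡n n) (∣concat-replicate∣ m C))

module _ {n m : ℕ} (G : Graph n) (H : Graph m) where

  private
    Γ : Graph (n + n * m)
    Γ = corona G H

  -- The projection to G of a walk of length k in G ⊙ H; depth accounts for the edge into a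
  -- leaf, which the projection loses.
  ShadowWalk : CVertex n m → CVertex n m → ℕ → Set
  ShadowWalk s t k = ∃[ k′ ] Walk G (host s) (host t) k′ × depth t + k′ ≤ depth s + k

  shadow-step : ∀ {k} s t r → CAdj G H s t → ShadowWalk t r k → ShadowWalk s r (suc k)
  shadow-step (inj₁ i) (inj₁ j) r e (k′ , W , le) =
    suc k′ , step e W , ≤-trans (≤-reflexive (+-suc (depth r) k′)) (s≤s le)
  shadow-step (inj₁ i) (inj₂ _) r refl (k′ , W , le) = k′ , W , le
  shadow-step (inj₂ _) (inj₁ j) r refl (k′ , W , le) = k′ , W , m≤n⇒m≤1+n (m≤n⇒m≤1+n le)
  shadow-step (inj₂ _) (inj₂ _) r (refl , _) (k′ , W , le) = k′ , W , m≤n⇒m≤1+n le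

  shadow : ∀ {x y k} → Walk Γ x y k → ShadowWalk (decode n m x) (decode n m y) k
  shadow here = 0 , here , ≤-refl
  shadow {x} {y} (step {v = v} e W) =
    shadow-step (decode n m x) (decode n m v) (decode n m y) e (shadow W)

  base-adj : ∀ {i j} → Adj G i j → Adj Γ (base i) (base j)
  base-adj {i} {j} = subst₂ (CAdj G H) (sym (decode-base i)) (sym (decode-base j))

  base-leaf-adj : ∀ i a → Adj Γ (base i) (leaf i a)
  base-leaf-adj i a = subst₂ (CAdj G H) (sym (decode-base i)) (sym (decode-leaf i a)) refl

  walk-to-leaf : ∀ {w i d} → Walk G w i d → ∀ a → Walk Γ (base w) (leaf i a) (suc d)
  walk-to-leaf {w} here        a = step (base-leaf-adj w a) here
  walk-to-leaf     (step e W) a = step (base-adj e) (walk-to-leaf W a)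

  dist-to-leaf : ∀ {w i d} → Dist G w i d → ∀ a → Dist Γ (base w) (leaf i a) (suc d)
  dist-to-leaf {w} {i} {d} (W , shortest) a = walk-to-leaf W a , longer
    where
    longer : ∀ k → Walk Γ (base w) (leaf i a) k → suc d ≤ k
    longer k W′ =
      let k′ , W″ , le = subst₂ (λ s t → ShadowWalk s t k)
                                (decode-base w) (decode-leaf i a) (shadow W′)
      in ≤-trans (s≤s (shortest k′ W″)) le

  equidistant-leaves : ∀ {w i j} → Equidistant G w i j →
                       ∀ a b → Equidistant Γ (base w) (leaf i a) (leaf j b)
  equidistant-leaves (d , wi , wj) a b = suc d , dist-to-leaf wi a , dist-to-leaf wj b

  module _ {C : Subset n} (cover : IsVertexCover (emptyBisector G) C) where

    private
      S : Subset (n + n * m)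
      S = basesAndLeavesOver C

    outside-¬¬-equalized : ∀ u v → u ∉ S → v ∉ S →
                           ¬ ¬ (Σ (Fin (n + n * m)) λ w → w ∈ S × Equidistant Γ w u v)
    outside-¬¬-equalized u v = equalize (coronaView u) (coronaView v)
      where
      equalize : ∀ {u v} → CoronaView {n} {m} u → CoronaView {n} {m} v → u ∉ S → v ∉ S →
                 ¬ ¬ (Σ (Fin (n + n * m)) λ w → w ∈ S × Equidistant Γ w u v)
      equalize (base-view i)   _              u∉S _   = contradiction (base∈ C i) u∉S
      equalize (leaf-view _ _) (base-view j)  _   v∉S = contradiction (base∈ C j) v∉S
      equalize (leaf-view i a) (leaf-view j b) u∉S v∉S with i ≟ j
      ... | yes refl = λ ¬equalized →
        ¬equalized (base i , base∈ C i , equidistant-leaves (0 , dist-refl , dist-refl) a b)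
        where
        dist-refl : Dist G i i 0
        dist-refl = here , λ _ _ → z≤n
      ... | no i≢j =
        ¬¬-map (λ (w , w-equi) → base w , base∈ C w , equidistant-leaves w-equi a b)
               (λ ¬equi → [ u∉S ∘ leaf∈ C a , v∉S ∘ leaf∈ C b ]′ (cover i j (i≢j , ¬equi)))

    basesAndLeavesOver-isDistanceEqualizer : ¬ ¬ IsDistanceEqualizer Γ S
    basesAndLeavesOver-isDistanceEqualizer =
      ¬¬-map (λ equalized u v _ → equalized u v)
             (¬¬-∀-Fin λ u → ¬¬-∀-Fin λ v → ¬¬-→ λ u∉S → ¬¬-→ (outside-¬¬-equalized u v u∉S))

theorem21 : ∀ {n m : ℕ} (G : Graph n) (H : Graph m) → Connected G →
    ∀ (b x : ℕ) → IsVertexCoverNumber (emptyBisector G) b →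
    IsXi (corona G H) x →
    x ≤ b * order H + order G
theorem21 {n} {m} G H _ b x ((C , cover , ∣C∣≡b) , _) (_ , minimal) =
  decidable-stable (x ≤? b * m + n) (¬¬-map bound (basesAndLeavesOver-isDistanceEqualizer G H cover))
  where
  open ≤-Reasoning
  bound : IsDistanceEqualizer (corona G H) (basesAndLeavesOver C) → x ≤ b * m + n
  bound equalizer = begin
    x                            ≤⟨ minimal _ equalizer ⟩
    ∣ basesAndLeavesOver C ∣     ≡⟨ ∣basesAndLeavesOver∣ C ⟩
    n + ∣ C ∣ * m                ≡⟨ +-comm n _ ⟩
    ∣ C ∣ * m + n                ≡⟨ cong (λ c → c * m + n) ∣C∣≡b ⟩
    b * m + n                    ∎
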